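{- Let $S_1=K_1$ and, for $n\ge 2$, let $S_n=s(S_{n-1})$. Let $\Gamma$ be the class of all graphs isomorphic to an induced subgraph of some $S_n$, $n\ge 1$. Then every graph $G\in\Gamma$ satisfies $\mathrm{td}(G)\le 2\omega(G)$.
   Context: All graphs are finite, simple and undirected; $\omega(G)$ is the clique number. The s-claw substitution $s(G)$ of $G$ is obtained from the disjoint union of three copies $G_1,G_2,G_3$ of $G$ by adding new vertices $v_1,v_2,v_3$ with each $v_i$ adjacent to all vertices of $G_i$, and a new vertex $w$ adjacent precisely to $v_1,v_2,v_3$. A rooted forest is a disjoint union of rooted trees; its depth is the maximum number of vertices on a root-to-leaf path; its transitive closure is obtained by making every root-to-leaf path a clique. A treedepth decomposition of $G$ is a rooted forest $F$ with $V(F)=V(G)$ such that $G$ is a subgraph of the transitive closure of $F$; the treedepth $\mathrm{td}(G)$ is the minimum depth of a treedepth decomposition of $G$. -}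

module Defs where

open import Data.Nat using (ℕ; zero; suc; _+_; _*_; _≤_)
open import Data.Fin using (Fin; zero; suc; splitAt)
open import Data.Bool using (Bool; true; false; _∧_)
open import Data.Maybe using (Maybe; just; nothing)
open import Data.Sum using (_⊎_; inj₁; inj₂)
open import Data.Product using (Σ; _×_; _,_; ∃)
open import Function.Definitions using (Injective)
open import Relation.Binary.PropositionalEquality using (_≡_; refl)
open import Relation.Binary.Construct.Closure.ReflexiveTransitive using (Star)

record Graph : Set where
  field
    size    : ℕ
    adj     : Fin size → Fin size → Bool
    adj-sym : ∀ x y → adj x y ≡ adj y x
    adj-irr : ∀ x → adj x x ≡ false

open Graph public

K1 : Graph
K1 = record { size = 1 ; adj = λ _ _ → false
            ; adj-sym = λ _ _ → refl ; adj-irr = λ _ → refl }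

data Three : Set where
  one two three : Three

_==₃_ : Three → Three → Bool
one   ==₃ one   = true
two   ==₃ two   = true
three ==₃ three = true
_     ==₃ _     = false

==₃-sym : ∀ i j → (i ==₃ j) ≡ (j ==₃ i)
==₃-sym one one = refl
==₃-sym one two = refl
==₃-sym one three = refl
==₃-sym two one = refl
==₃-sym two two = refl
==₃-sym two three = refl
==₃-sym three one = refl
==₃-sym three two = refl
==₃-sym three three = refl

data SVert (n : ℕ) : Set where
  w    : SVert n
  v    : Three → SVert n
  copy : Three → Fin n → SVert n

module _ (G : Graph) where
  private
    n = size G

  sAdj : SVert n → SVert n → Bool
  sAdj w        (v _)      = true
  sAdj (v _)    w          = true
  sAdj (v i)    (copy j _) = i ==₃ j
  sAdj (copy j _) (v i)    = j ==₃ i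
  sAdj (copy i x) (copy j y) = (i ==₃ j) ∧ adj G x y
  sAdj _        _          = false

  sAdj-sym : ∀ a b → sAdj a b ≡ sAdj b a
  sAdj-sym w w = refl
  sAdj-sym w (v _) = refl
  sAdj-sym w (copy _ _) = refl
  sAdj-sym (v _) w = refl
  sAdj-sym (v i) (v j) = refl
  sAdj-sym (v i) (copy j _) = ==₃-sym i j
  sAdj-sym (copy _ _) w = refl
  sAdj-sym (copy j _) (v i) = ==₃-sym j i
  sAdj-sym (copy i x) (copy j y) rewrite ==₃-sym i j | adj-sym G x y = refl

  sAdj-irr : ∀ a → sAdj a a ≡ false
  sAdj-irr w = refl
  sAdj-irr (v _) = refl
  sAdj-irr (copy one x) = adj-irr G x
  sAdj-irr (copy two x) = adj-irr G x
  sAdj-irr (copy three x) = adj-irr G x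

  decode : Fin (4 + (n + (n + n))) → SVert n
  decode zero = w
  decode (suc zero) = v one
  decode (suc (suc zero)) = v two
  decode (suc (suc (suc zero))) = v three
  decode (suc (suc (suc (suc i)))) with splitAt n i
  ... | inj₁ x = copy one x
  ... | inj₂ j with splitAt n j
  ...   | inj₁ x = copy two x
  ...   | inj₂ x = copy three x

  sclaw : Graph
  sclaw = record
    { size = 4 + (n + (n + n))
    ; adj = λ x y → sAdj (decode x) (decode y)
    ; adj-sym = λ x y → sAdj-sym (decode x) (decode y)
    ; adj-irr = λ x → sAdj-irr (decode x) }

-- S' m = S_{m+1}:  S_1 = K₁, S_{n} = s(S_{n-1})
S' : ℕ → Graph
S' zero    = K1
S' (suc m) = sclaw (S' m)

IsoInducedSub : Graph → Graph → Set
IsoInducedSub G H =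
  Σ (Fin (size G) → Fin (size H)) λ f →
    Injective _≡_ _≡_ f × (∀ x y → adj G x y ≡ adj H (f x) (f y))

InΓ : Graph → Set
InΓ G = ∃ λ m → IsoInducedSub G (S' m)

HasClique : Graph → ℕ → Set
HasClique G k =
  Σ (Fin k → Fin (size G)) λ f →
    Injective _≡_ _≡_ f × (∀ i j → f i ≡ f j ⊎ adj G (f i) (f j) ≡ true)

IsCliqueNumber : Graph → ℕ → Set
IsCliqueNumber G k = HasClique G k × (∀ m → HasClique G m → m ≤ k)

-- A rooted forest on Fin n, given by a parent map; `level x` is the
-- number of vertices on the path from x up to its root (its existence
-- forces acyclicity).
record RootedForest (n : ℕ) : Set where
  field
    parent     : Fin n → Maybe (Fin n)
    level      : Fin n → ℕ
    level-root : ∀ x → parent x ≡ nothing → level x ≡ 1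
    level-step : ∀ x y → parent x ≡ just y → level x ≡ suc (level y)

  -- Ancestor x y : y is an ancestor of x (or y ≡ x)
  Ancestor : Fin n → Fin n → Set
  Ancestor = Star (λ a b → parent a ≡ just b)

  -- adjacency in the transitive closure (root-to-leaf paths are cliques)
  Comparable : Fin n → Fin n → Set
  Comparable x y = Ancestor x y ⊎ Ancestor y x

  DepthAtMost : ℕ → Set
  DepthAtMost t = ∀ x → level x ≤ t

open RootedForest public

IsTDDecomp : (G : Graph) → RootedForest (size G) → Set
IsTDDecomp G F = ∀ x y → adj G x y ≡ true → Comparable F x y

TreedepthAtMost : Graph → ℕ → Set
TreedepthAtMost G t =
  Σ (RootedForest (size G)) λ F → IsTDDecomp G F × DepthAtMost F t

-- Address the vertices of S_{m+1} as w, v i, or copy i a with a an address in S_m.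
-- For a vertex set U, take w as a root, hang each v i ∈ U below w (if w ∈ U), and
-- hang the recursively built forest of U ∩ copy i below v i; if v i ∉ U those trees
-- simply stay roots, which is sound because v i separates copy i from the rest.
-- Descending into copy i lengthens a root path only if v i ∈ U, and then by at most
-- two (v i and w). The spokes v i ∈ U met along the address of a vertex form, together
-- with that vertex, a clique, so every root path has at most 2ω vertices.
module Submission where

open import Defs
open import Data.Nat using (ℕ; zero; suc; _+_; _*_; _≤_; z≤n; s≤s)
open import Data.Nat.Properties
  using (≤-trans; ≤-refl; ≤-reflexive; +-identityʳ; +-mono-≤; *-monoʳ-≤; *-suc; +-comm; suc-injective)
open import Data.Fin using (Fin; zero; suc; splitAt; _↑ˡ_; _↑ʳ_)
open import Data.Fin.Properties using (splitAt⁻¹-↑ˡ; splitAt⁻¹-↑ʳ; any?)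
open import Data.Bool using (Bool; true; false; _∧_; if_then_else_)
open import Data.Bool.Properties using (T-≡)
open import Data.Maybe using (Maybe; just; nothing; maybe′; when; _>>=_)
open import Data.Maybe.Properties using (just-injective)
open import Data.Sum using (_⊎_; inj₁; inj₂; map; map₂)
open import Data.Product using (Σ; _×_; _,_; ∃; proj₁; proj₂)
open import Data.Vec.Functional using (_∷_)
open import Function using (_∘_; case_of_)
open import Function.Bundles using (Equivalence)
open import Function.Definitions using (Injective)
open import Relation.Nullary using (Dec; yes; no)
open import Relation.Nullary.Decidable using (isYes; toWitness; fromWitness)
open import Relation.Binary.Definitions using (DecidableEquality)
open import Relation.Binary.PropositionalEquality using (_≡_; refl; sym; trans; cong; cong₂; subst)
open import Relation.Binary.Construct.Closure.ReflexiveTransitive using (Star; ε; _◅_; _◅◅_)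

private variable
  m n c : ℕ

==₃-refl : ∀ i → (i ==₃ i) ≡ true
==₃-refl one   = refl
==₃-refl two   = refl
==₃-refl three = refl

==₃⇒≡ : ∀ {i j} → (i ==₃ j) ≡ true → i ≡ j
==₃⇒≡ {one}   {one}   _ = refl
==₃⇒≡ {two}   {two}   _ = refl
==₃⇒≡ {three} {three} _ = refl
==₃⇒≡ {one}   {two}   ()
==₃⇒≡ {one}   {three} ()
==₃⇒≡ {two}   {one}   ()
==₃⇒≡ {two}   {three} ()
==₃⇒≡ {three} {one}   ()
==₃⇒≡ {three} {two}   ()

_≟₃_ : DecidableEquality Three
i ≟₃ j with i ==₃ j in e
... | true  = yes (==₃⇒≡ e)
... | false = no λ { refl → case trans (sym e) (==₃-refl i) of λ () }

-- Addresses of the vertices of S_m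

data Address : ℕ → Set where
  root : Address zero
  w    : Address (suc m)
  v    : Three → Address (suc m)
  copy : Three → Address m → Address (suc m)

adjᴬ : Address m → Address m → Bool
adjᴬ w          (v _)      = true
adjᴬ (v _)      w          = true
adjᴬ (v i)      (copy j _) = i ==₃ j
adjᴬ (copy j _) (v i)      = j ==₃ i
adjᴬ (copy i a) (copy j b) = (i ==₃ j) ∧ adjᴬ a b
adjᴬ _          _          = false

adjᴬ-copy : ∀ i (a b : Address m) → adjᴬ (copy i a) (copy i b) ≡ adjᴬ a b
adjᴬ-copy i a b rewrite ==₃-refl i = refl

copy-injective : ∀ {i j} {a b : Address m} → copy i a ≡ copy j b → i ≡ j × a ≡ b
copy-injective refl = refl , refl

_≟ᴬ_ : DecidableEquality (Address m)
root     ≟ᴬ root     = yes refl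
w        ≟ᴬ w        = yes refl
v i      ≟ᴬ v j      with i ≟₃ j
... | yes refl = yes refl
... | no  i≢j  = no λ { refl → i≢j refl }
copy i a ≟ᴬ copy j b with i ≟₃ j | a ≟ᴬ b
... | yes refl | yes refl = yes refl
... | no  i≢j  | _        = no λ { refl → i≢j refl }
... | _        | no  a≢b  = no λ { refl → a≢b refl }
w        ≟ᴬ v _      = no λ ()
w        ≟ᴬ copy _ _ = no λ ()
v _      ≟ᴬ w        = no λ ()
v _      ≟ᴬ copy _ _ = no λ ()
copy _ _ ≟ᴬ w        = no λ ()
copy _ _ ≟ᴬ v _      = no λ ()

fromSVert : (Fin n → Address m) → SVert n → Address (suc m)
fromSVert t w          = w
fromSVert t (v i)      = v i
fromSVert t (copy i x) = copy i (t x)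

fromSVert-injective : (t : Fin n → Address m) → Injective _≡_ _≡_ t →
                      Injective _≡_ _≡_ (fromSVert t)
fromSVert-injective t t-inj {w}        {w}        _ = refl
fromSVert-injective t t-inj {v i}      {v .i}     refl = refl
fromSVert-injective t t-inj {copy i x} {copy j y} e with copy-injective e
... | refl , tx≡ty = cong (copy i) (t-inj tx≡ty)
fromSVert-injective t t-inj {w}        {v _}      ()
fromSVert-injective t t-inj {w}        {copy _ _} ()
fromSVert-injective t t-inj {v _}      {w}        ()
fromSVert-injective t t-inj {v _}      {copy _ _} ()
fromSVert-injective t t-inj {copy _ _} {w}        ()
fromSVert-injective t t-inj {copy _ _} {v _}      ()

fromSVert-adj : (G : Graph) (t : Fin (size G) → Address m) →
                (∀ x y → adj G x y ≡ adjᴬ (t x) (t y)) →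
                ∀ p q → sAdj G p q ≡ adjᴬ (fromSVert t p) (fromSVert t q)
fromSVert-adj G t t-adj (copy i x) (copy j y) = cong ((i ==₃ j) ∧_) (t-adj x y)
fromSVert-adj G t t-adj w          w          = refl
fromSVert-adj G t t-adj w          (v _)      = refl
fromSVert-adj G t t-adj w          (copy _ _) = refl
fromSVert-adj G t t-adj (v _)      w          = refl
fromSVert-adj G t t-adj (v _)      (v _)      = refl
fromSVert-adj G t t-adj (v _)      (copy _ _) = refl
fromSVert-adj G t t-adj (copy _ _) w          = refl
fromSVert-adj G t t-adj (copy _ _) (v _)      = refl

module _ (G : Graph) where
  private n′ = size G

  encode : SVert n′ → Fin (size (sclaw G))
  encode w              = zero
  encode (v one)        = suc zero
  encode (v two)        = suc (suc zero)
  encode (v three)      = suc (suc (suc zero))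
  encode (copy one x)   = suc (suc (suc (suc (x ↑ˡ (n′ + n′)))))
  encode (copy two x)   = suc (suc (suc (suc (n′ ↑ʳ (x ↑ˡ n′)))))
  encode (copy three x) = suc (suc (suc (suc (n′ ↑ʳ (n′ ↑ʳ x)))))

  encode∘decode : ∀ i → encode (decode G i) ≡ i
  encode∘decode zero                   = refl
  encode∘decode (suc zero)             = refl
  encode∘decode (suc (suc zero))       = refl
  encode∘decode (suc (suc (suc zero))) = refl
  encode∘decode (suc (suc (suc (suc i)))) with splitAt n′ i in e₁
  ... | inj₁ x = cong (λ z → suc (suc (suc (suc z)))) (splitAt⁻¹-↑ˡ e₁)
  ... | inj₂ j with splitAt n′ j in e₂
  ...   | inj₁ x = cong (λ z → suc (suc (suc (suc z))))
                     (trans (cong (n′ ↑ʳ_) (splitAt⁻¹-↑ˡ e₂)) (splitAt⁻¹-↑ʳ e₁))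
  ...   | inj₂ x = cong (λ z → suc (suc (suc (suc z))))
                     (trans (cong (n′ ↑ʳ_) (splitAt⁻¹-↑ʳ e₂)) (splitAt⁻¹-↑ʳ e₁))

  decode-injective : Injective _≡_ _≡_ (decode G)
  decode-injective {i} {j} e =
    trans (sym (encode∘decode i)) (trans (cong encode e) (encode∘decode j))

toAddress : ∀ m → Fin (size (S' m)) → Address m
toAddress zero    _ = root
toAddress (suc m) x = fromSVert (toAddress m) (decode (S' m) x)

toAddress-injective : ∀ m → Injective _≡_ _≡_ (toAddress m)
toAddress-injective zero    {zero} {zero} _ = refl
toAddress-injective (suc m) e =
  decode-injective (S' m) (fromSVert-injective (toAddress m) (toAddress-injective m) e)

adj-toAddress : ∀ m x y → adj (S' m) x y ≡ adjᴬ (toAddress m x) (toAddress m y)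
adj-toAddress zero    _ _ = refl
adj-toAddress (suc m) x y =
  fromSVert-adj (S' m) (toAddress m) (adj-toAddress m) (decode (S' m) x) (decode (S' m) y)

record Forest (X : Set) : Set where
  field
    parentᶠ     : X → Maybe X
    levelᶠ      : X → ℕ
    levelᶠ-root : ∀ a → parentᶠ a ≡ nothing → levelᶠ a ≡ 1
    levelᶠ-step : ∀ a b → parentᶠ a ≡ just b → levelᶠ a ≡ suc (levelᶠ b)

  Ancestorᶠ : X → X → Set
  Ancestorᶠ = Star (λ a b → parentᶠ a ≡ just b)

  reachesRoot : ∀ a → ∃ λ r → Ancestorᶠ a r × parentᶠ r ≡ nothing
  reachesRoot a = go (levelᶠ a) a refl
    where
      go : ∀ k a → levelᶠ a ≡ k → ∃ λ r → Ancestorᶠ a r × parentᶠ r ≡ nothing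
      go k a a≡k with parentᶠ a in p
      ... | nothing = a , ε , p
      ... | just b with k | trans (sym (levelᶠ-step a b p)) a≡k
      ...   | suc k′ | b≡k′ with go k′ b (suc-injective b≡k′)
      ...     | r , b→r , r-root = r , p ◅ b→r , r-root

open Forest

-- The forest of a vertex set U of S_m

inCopy : (Address (suc m) → Bool) → Three → Address m → Bool
inCopy U i a = U (copy i a)

spokeLevel : Bool → ℕ
spokeLevel hubPresent = if hubPresent then 2 else 1

-- the level of the parent of the roots of the forest of copy i (0 if there is none)
attachmentLevel : (Address (suc m) → Bool) → Three → ℕ
attachmentLevel U i = if U (v i) then spokeLevel (U w) else 0

parentᵁ : (Address m → Bool) → Address m → Maybe (Address m)
parentᵁ U root       = nothing
parentᵁ U w          = nothing
parentᵁ U (v i)      = when (U w) w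
parentᵁ U (copy i a) = maybe′ (just ∘ copy i) (when (U (v i)) (v i)) (parentᵁ (inCopy U i) a)

levelᵁ : (Address m → Bool) → Address m → ℕ
levelᵁ U root       = 1
levelᵁ U w          = 1
levelᵁ U (v i)      = spokeLevel (U w)
levelᵁ U (copy i a) = levelᵁ (inCopy U i) a + attachmentLevel U i

levelᵁ-root : ∀ U (a : Address m) → parentᵁ U a ≡ nothing → levelᵁ U a ≡ 1
levelᵁ-root U root _ = refl
levelᵁ-root U w    _ = refl
levelᵁ-root U (v i)  e with U w
... | false = refl
levelᵁ-root U (copy i a) e with parentᵁ (inCopy U i) a in p | U (v i)
... | nothing | false = trans (+-identityʳ _) (levelᵁ-root (inCopy U i) a p)

levelᵁ-step : ∀ U (a b : Address m) → parentᵁ U a ≡ just b → levelᵁ U a ≡ suc (levelᵁ U b)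
levelᵁ-step U (v i) _ e with U w
levelᵁ-step U (v i) _ refl | true = refl
levelᵁ-step U (copy i a) _ e with parentᵁ (inCopy U i) a in p
levelᵁ-step U (copy i a) _ refl | just b =
  cong (_+ attachmentLevel U i) (levelᵁ-step (inCopy U i) a b p)
... | nothing with U (v i)
levelᵁ-step U (copy i a) _ refl | nothing | true =
  cong (_+ spokeLevel (U w)) (levelᵁ-root (inCopy U i) a p)

parentᵁ-∈ : ∀ U (a b : Address m) → parentᵁ U a ≡ just b → U b ≡ true
parentᵁ-∈ U (v i) _ e with U w in w∈U
parentᵁ-∈ U (v i) _ refl | true = w∈U
parentᵁ-∈ U (copy i a) _ e with parentᵁ (inCopy U i) a in p | U (v i) in vᵢ∈U
parentᵁ-∈ U (copy i a) _ refl | just b  | _    = parentᵁ-∈ (inCopy U i) a b p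
parentᵁ-∈ U (copy i a) _ refl | nothing | true = vᵢ∈U

addressForest : (Address m → Bool) → Forest (Address m)
addressForest U = record
  { parentᶠ = parentᵁ U ; levelᶠ = levelᵁ U
  ; levelᶠ-root = levelᵁ-root U ; levelᶠ-step = levelᵁ-step U }

Ancestorᵁ : (Address m → Bool) → Address m → Address m → Set
Ancestorᵁ U = Ancestorᶠ (addressForest U)

parent-v : ∀ U i → U w ≡ true → parentᵁ {suc m} U (v i) ≡ just w
parent-v U i w∈U rewrite w∈U = refl

ancestor-copy : ∀ U i {a b : Address m} → Ancestorᵁ (inCopy U i) a b →
                Ancestorᵁ U (copy i a) (copy i b)
ancestor-copy U i ε = ε
ancestor-copy U i {a} (p ◅ a→b) = step {a} p ◅ ancestor-copy U i a→b
  where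
    step : ∀ {a c} → parentᵁ (inCopy U i) a ≡ just c → parentᵁ U (copy i a) ≡ just (copy i c)
    step p rewrite p = refl

ancestor-v : ∀ U i → U (v i) ≡ true → (a : Address m) → Ancestorᵁ U (copy i a) (v i)
ancestor-v U i vᵢ∈U a with reachesRoot (addressForest (inCopy U i)) a
... | r , a→r , r-root = ancestor-copy U i a→r ◅◅ (parent-r ◅ ε)
  where
    parent-r : parentᵁ U (copy i r) ≡ just (v i)
    parent-r rewrite r-root | vᵢ∈U = refl

adjacent⇒comparable : ∀ U {a b : Address m} → U a ≡ true → U b ≡ true → adjᴬ a b ≡ true →
                      Ancestorᵁ U a b ⊎ Ancestorᵁ U b a
adjacent⇒comparable U {w}   {v i} w∈U _ _ = inj₂ (parent-v U i w∈U ◅ ε)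
adjacent⇒comparable U {v i} {w}   _ w∈U _ = inj₁ (parent-v U i w∈U ◅ ε)
adjacent⇒comparable U {v i} {copy j b} vᵢ∈U _ e with ==₃⇒≡ e
... | refl = inj₂ (ancestor-v U i vᵢ∈U b)
adjacent⇒comparable U {copy j a} {v i} _ vᵢ∈U e with ==₃⇒≡ e
... | refl = inj₁ (ancestor-v U i vᵢ∈U a)
adjacent⇒comparable U {copy i a} {copy j b} a∈U b∈U e with i ==₃ j in i=j
... | true with ==₃⇒≡ i=j
...   | refl with adjacent⇒comparable (inCopy U i) a∈U b∈U e
...     | inj₁ a→b = inj₁ (ancestor-copy U i a→b)
...     | inj₂ b→a = inj₂ (ancestor-copy U i b→a)

IsClique : {X : Set} → (X → X → Bool) → (Fin c → X) → Set
IsClique R g = ∀ i j → i ≡ j ⊎ R (g i) (g j) ≡ true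

CliqueIn : (Address m → Bool) → ℕ → Set
CliqueIn U c = Σ (Fin c → Address _) λ g → (∀ i → U (g i) ≡ true) × IsClique adjᴬ g

singletonClique : ∀ U {a : Address m} → U a ≡ true → CliqueIn U 1
singletonClique U {a} a∈U = (λ _ → a) , (λ _ → a∈U) , λ { zero zero → inj₁ refl }

copyClique : ∀ U i → CliqueIn {m} (inCopy U i) c → CliqueIn U c
copyClique U i (g , g∈U , g-clique) = (λ x → copy i (g x)) , g∈U , clique
  where
    clique : IsClique adjᴬ (λ x → copy i (g x))
    clique j k = map₂ (trans (adjᴬ-copy i (g j) (g k))) (g-clique j k)

spokeClique : ∀ U i → U (v i) ≡ true → CliqueIn {m} (inCopy U i) c → CliqueIn U (suc c)
spokeClique U i vᵢ∈U (g , g∈U , g-clique) = v i ∷ (λ x → copy i (g x)) , ∈U , clique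
  where
    ∈U : ∀ j → U ((v i ∷ (λ x → copy i (g x))) j) ≡ true
    ∈U zero    = vᵢ∈U
    ∈U (suc j) = g∈U j
    clique : IsClique adjᴬ (v i ∷ (λ x → copy i (g x)))
    clique zero    zero    = inj₁ refl
    clique zero    (suc k) = inj₂ (==₃-refl i)
    clique (suc j) zero    = inj₂ (==₃-refl i)
    clique (suc j) (suc k) =
      map (cong suc) (trans (adjᴬ-copy i (g j) (g k))) (g-clique j k)

spokeLevel≤2 : ∀ b → spokeLevel b ≤ 2
spokeLevel≤2 true  = ≤-refl
spokeLevel≤2 false = s≤s z≤n

levelᵁ≤2*clique : ∀ U {a : Address m} → U a ≡ true →
                  ∃ λ c → CliqueIn U c × levelᵁ U a ≤ 2 * c
levelᵁ≤2*clique U {root} a∈U = 1 , singletonClique U a∈U , s≤s z≤n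
levelᵁ≤2*clique U {w}    a∈U = 1 , singletonClique U a∈U , s≤s z≤n
levelᵁ≤2*clique U {v i}  a∈U = 1 , singletonClique U a∈U , spokeLevel≤2 (U w)
levelᵁ≤2*clique U {copy i a} a∈U with levelᵁ≤2*clique (inCopy U i) a∈U | U (v i) in vᵢ∈U
... | c , K , a≤2c | false =
  c , copyClique U i K , ≤-trans (≤-reflexive (+-identityʳ _)) a≤2c
... | c , K , a≤2c | true =
  suc c , spokeClique U i vᵢ∈U K ,
  ≤-trans (+-mono-≤ a≤2c (spokeLevel≤2 (U w)))
          (≤-reflexive (trans (+-comm (2 * c) 2) (sym (*-suc 2 c))))

-- Pulling structure back along an embedding of a graph

module Embedding {X : Set} (_≟_ : DecidableEquality X) (R : X → X → Bool)
                 (G : Graph) (h : Fin (size G) → X) (h-injective : Injective _≡_ _≡_ h)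
                 (h-adj : ∀ x y → adj G x y ≡ R (h x) (h y)) where

  image? : ∀ a → Dec (∃ λ x → h x ≡ a)
  image? a = any? λ x → h x ≟ a

  inImage : X → Bool
  inImage a = isYes (image? a)

  inImage-h : ∀ x → inImage (h x) ≡ true
  inImage-h x = Equivalence.to T-≡ (fromWitness (x , refl))

  fromImage : ∀ {a} → inImage a ≡ true → ∃ λ x → h x ≡ a
  fromImage e = toWitness (Equivalence.from T-≡ e)

  preimage : X → Maybe (Fin (size G))
  preimage a with image? a
  ... | yes (x , _) = just x
  ... | no _        = nothing

  preimage-complete : ∀ {a} → inImage a ≡ true → ∃ λ x → preimage a ≡ just x × h x ≡ a
  preimage-complete {a} e with image? a
  preimage-complete e  | yes (x , hx≡a) = x , refl , hx≡a
  preimage-complete () | no _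

  preimage-sound : ∀ {a x} → preimage a ≡ just x → h x ≡ a
  preimage-sound {a} e with image? a
  ... | yes (x , hx≡a) = trans (cong h (sym (just-injective e))) hx≡a

  module _ (F : Forest X) (closed : ∀ a b → parentᶠ F a ≡ just b → inImage b ≡ true) where

    parentᵖ : Fin (size G) → Maybe (Fin (size G))
    parentᵖ x = parentᶠ F (h x) >>= preimage

    parentᵖ-complete : ∀ {x b} → parentᶠ F (h x) ≡ just b →
                       ∃ λ y → parentᵖ x ≡ just y × h y ≡ b
    parentᵖ-complete p with preimage-complete (closed _ _ p)
    ... | y , py , hy≡b rewrite p = y , py , hy≡b

    parentᵖ-just : ∀ {x y} → parentᵖ x ≡ just y → parentᶠ F (h x) ≡ just (h y)
    parentᵖ-just {x} e with parentᶠ F (h x)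
    ... | just b  = cong just (sym (preimage-sound e))
    ... | nothing = case e of λ ()

    parentᵖ-nothing : ∀ {x} → parentᵖ x ≡ nothing → parentᶠ F (h x) ≡ nothing
    parentᵖ-nothing {x} e with parentᶠ F (h x) in p
    ... | nothing = refl
    ... | just b with preimage-complete (closed _ _ p)
    ...   | y , py , _ = case trans (sym e) py of λ ()

    pullback : RootedForest (size G)
    pullback = record
      { parent = parentᵖ ; level = levelᶠ F ∘ h
      ; level-root = λ _ e → levelᶠ-root F _ (parentᵖ-nothing e)
      ; level-step = λ _ _ e → levelᶠ-step F _ _ (parentᵖ-just e) }

    ancestor-pullback : ∀ {a b} → Ancestorᶠ F a b →
                        ∀ {x y} → h x ≡ a → h y ≡ b → Ancestor pullback x y
    ancestor-pullback ε hx≡a hy≡a =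
      subst (Ancestor pullback _) (h-injective (trans hx≡a (sym hy≡a))) ε
    ancestor-pullback (p ◅ c→b) refl hy≡b with parentᵖ-complete p
    ... | z , pz , hz≡c = pz ◅ ancestor-pullback c→b hz≡c hy≡b

    pullback-decomposes : (∀ {a b} → inImage a ≡ true → inImage b ≡ true → R a b ≡ true →
                                     Ancestorᶠ F a b ⊎ Ancestorᶠ F b a) →
                          IsTDDecomp G pullback
    pullback-decomposes comparable x y xy
      with comparable (inImage-h x) (inImage-h y) (trans (sym (h-adj x y)) xy)
    ... | inj₁ a→b = inj₁ (ancestor-pullback a→b refl refl)
    ... | inj₂ b→a = inj₂ (ancestor-pullback b→a refl refl)

  clique-preimage : (g : Fin c → X) → (∀ i → inImage (g i) ≡ true) → IsClique R g →
                    HasClique G c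
  clique-preimage g g∈ g-clique = f , f-injective , f-clique
    where
      f : Fin _ → Fin (size G)
      f i = proj₁ (fromImage (g∈ i))
      hf≡g : ∀ i → h (f i) ≡ g i
      hf≡g i = proj₂ (fromImage (g∈ i))
      R≡adj : ∀ i j → R (g i) (g j) ≡ adj G (f i) (f j)
      R≡adj i j = trans (cong₂ R (sym (hf≡g i)) (sym (hf≡g j))) (sym (h-adj (f i) (f j)))
      f-injective : Injective _≡_ _≡_ f
      f-injective {i} {j} fi≡fj with g-clique i j
      ... | inj₁ i≡j = i≡j
      ... | inj₂ gi∼gj = case trans (sym gi∼gj) (trans (R≡adj i j) fi≁fj) of λ ()
        where
          fi≁fj : adj G (f i) (f j) ≡ false
          fi≁fj rewrite fi≡fj = adj-irr G (f j)
      f-clique : ∀ i j → f i ≡ f j ⊎ adj G (f i) (f j) ≡ true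
      f-clique i j = map (cong f) (trans (sym (R≡adj i j))) (g-clique i j)

lemma4p4 : (G : Graph) → InΓ G → (k : ℕ) → IsCliqueNumber G k →
    TreedepthAtMost G (2 * k)
lemma4p4 G (m , f , f-injective , f-adj) k (_ , ω-maximal) =
  pullback F closed , pullback-decomposes F closed (adjacent⇒comparable inImage) , depth
  where
    h : Fin (size G) → Address m
    h = toAddress m ∘ f
    open Embedding _≟ᴬ_ adjᴬ G h (f-injective ∘ toAddress-injective m)
                   (λ x y → trans (f-adj x y) (adj-toAddress m (f x) (f y)))
    F : Forest (Address m)
    F = addressForest inImage
    closed : ∀ a b → parentᶠ F a ≡ just b → inImage b ≡ true
    closed = parentᵁ-∈ inImage
    depth : DepthAtMost (pullback F closed) (2 * k)
    depth x with levelᵁ≤2*clique inImage (inImage-h x)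
    ... | c , (g , g∈ , g-clique) , x≤2c =
      ≤-trans x≤2c (*-monoʳ-≤ 2 (ω-maximal c (clique-preimage g g∈ g-clique)))
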